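{- Let $\pi\mathbf{Ins}_{co}$ be the category of $\pi$-institutions and comorphisms and $U:\pi\mathbf{Ins}_{co}\to\mathbf{CAT}$ the forgetful functor sending each $\pi$-institution to its signature category and each comorphism to its first coordinate. Define $\top:\mathbf{CAT}\to\pi\mathbf{Ins}_{co}$ by $\top\mathcal A=\langle\mathcal A,*,\{\mathrm{Con}_a\}_{a\in|\mathcal A|}\rangle$, where $*:\mathcal A\to\mathbf{Set}$ is the constant functor with value the singleton $\{*\}$ and $\mathrm{Con}_a(\Gamma)=\{*\}$ for all $\Gamma\subseteq\{*\}$, and, for a functor $F:\mathcal A\to\mathcal B$, $\top F=\langle F,!\rangle$ where $!$ is the unique natural transformation $*\Rightarrow *\circ F$. Then $\top$ is a functor and $U$ and $\top$ establish an adjunction $U\dashv\top$ whose counit is $\varepsilon_{\mathcal A}=1_{\mathcal A}:U\top\mathcal A=\mathcal A\to\mathcal A$.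
   Context: A $\pi$-institution $J=\langle\mathit{Sig},\mathit{Sen},\{C_\Sigma\}_{\Sigma\in|\mathit{Sig}|}\rangle$ consists of a category $\mathit{Sig}$, a functor $\mathit{Sen}:\mathit{Sig}\to\mathbf{Set}$, and closure operators $C_\Sigma$ on $\mathcal P(\mathit{Sen}(\Sigma))$ such that $\mathit{Sen}(f)(C_{\Sigma_1}(\Gamma))\subseteq C_{\Sigma_2}(\mathit{Sen}(f)(\Gamma))$ for every $f:\Sigma_1\to\Sigma_2$ and $\Gamma\subseteq\mathit{Sen}(\Sigma_1)$. A comorphism $\langle\Phi,\alpha\rangle:J\to J'$ is a functor $\Phi:\mathit{Sig}\to\mathit{Sig}'$ with a natural transformation $\alpha:\mathit{Sen}\Rightarrow\mathit{Sen}'\Phi$ such that $\varphi\in C_\Sigma(\Gamma)$ implies $\alpha_\Sigma(\varphi)\in C'_{\Phi\Sigma}(\alpha_\Sigma(\Gamma))$ for all $\Gamma\cup\{\varphi\}\subseteq\mathit{Sen}(\Sigma)$; composition is $\langle G,\beta\rangle\cdot\langle F,\alpha\rangle=\langle GF,\beta F\cdot\alpha\rangle$ and identities are $\langle 1_{\mathit{Sig}},1_{\mathit{Sen}}\rangle$. $\mathbf{CAT}$ denotes the category of categories and functors. -}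

module Defs where

open import Level using (Level; _⊔_) renaming (suc to lsuc)
open import Relation.Binary.PropositionalEquality
  using (_≡_; refl; sym; trans; cong; subst)
open import Relation.Binary.Structures using (IsEquivalence)
open import Relation.Unary using (Pred; _⊆_; _∈_)
open import Data.Product using (Σ; ∃; _×_; _,_; proj₁; proj₂)
open import Data.Unit.Polymorphic using (⊤; tt)

record Category (o ℓ e : Level) : Set (lsuc (o ⊔ ℓ ⊔ e)) where
  infix  4 _≈_
  infixr 9 _∘_
  field
    Obj : Set o
    _⇒_ : Obj → Obj → Set ℓ
    _≈_ : ∀ {A B} → A ⇒ B → A ⇒ B → Set e
    id  : ∀ {A} → A ⇒ A
    _∘_ : ∀ {A B C} → B ⇒ C → A ⇒ B → A ⇒ C
    equiv     : ∀ {A B} → IsEquivalence (_≈_ {A} {B})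
    assoc     : ∀ {A B C D} {f : A ⇒ B} {g : B ⇒ C} {h : C ⇒ D} →
                (h ∘ g) ∘ f ≈ h ∘ (g ∘ f)
    identityˡ : ∀ {A B} {f : A ⇒ B} → id ∘ f ≈ f
    identityʳ : ∀ {A B} {f : A ⇒ B} → f ∘ id ≈ f
    ∘-resp-≈  : ∀ {A B C} {f h : B ⇒ C} {g i : A ⇒ B} →
                f ≈ h → g ≈ i → f ∘ g ≈ h ∘ i

record Functor {o ℓ e o′ ℓ′ e′ : Level}
               (C : Category o ℓ e) (D : Category o′ ℓ′ e′)
               : Set (o ⊔ ℓ ⊔ e ⊔ o′ ⊔ ℓ′ ⊔ e′) where
  private
    module C = Category C
    module D = Category D
  field
    F₀ : C.Obj → D.Obj
    F₁ : ∀ {A B} → A C.⇒ B → F₀ A D.⇒ F₀ B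
    identity     : ∀ {A} → F₁ (C.id {A}) D.≈ D.id
    homomorphism : ∀ {A B C′} {f : A C.⇒ B} {g : B C.⇒ C′} →
                   F₁ (g C.∘ f) D.≈ F₁ g D.∘ F₁ f
    F-resp-≈     : ∀ {A B} {f g : A C.⇒ B} → f C.≈ g → F₁ f D.≈ F₁ g

open Functor public

idF : ∀ {o ℓ e} (C : Category o ℓ e) → Functor C C
idF C = record
  { F₀ = λ A → A ; F₁ = λ f → f
  ; identity = refl′ ; homomorphism = refl′ ; F-resp-≈ = λ p → p }
  where open Category C
        refl′ : ∀ {A B} {f : A ⇒ B} → f ≈ f
        refl′ = IsEquivalence.refl equiv

infixr 9 _∘F_
_∘F_ : ∀ {o ℓ e o′ ℓ′ e′ o″ ℓ″ e″}
         {C : Category o ℓ e} {D : Category o′ ℓ′ e′} {E : Category o″ ℓ″ e″} →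
       Functor D E → Functor C D → Functor C E
_∘F_ {E = E} G F = record
  { F₀ = λ A → F₀ G (F₀ F A)
  ; F₁ = λ f → F₁ G (F₁ F f)
  ; identity = IsEquivalence.trans E.equiv (F-resp-≈ G (identity F)) (identity G)
  ; homomorphism = IsEquivalence.trans E.equiv (F-resp-≈ G (homomorphism F)) (homomorphism G)
  ; F-resp-≈ = λ p → F-resp-≈ G (F-resp-≈ F p) }
  where module E = Category E

coe : ∀ {o ℓ e} (D : Category o ℓ e) {A A′ B B′ : Category.Obj D} →
      A ≡ A′ → B ≡ B′ → Category._⇒_ D A B → Category._⇒_ D A′ B′
coe D refl refl f = f

-- equality of functors (the equality of morphisms in CAT):
-- equal on objects, and equal on morphisms up to that identification
record _≡F_ {o ℓ e o′ ℓ′ e′} {C : Category o ℓ e} {D : Category o′ ℓ′ e′}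
            (F G : Functor C D) : Set (o ⊔ ℓ ⊔ e′ ⊔ o′) where
  field
    eq₀ : ∀ X → F₀ F X ≡ F₀ G X
    eq₁ : ∀ {X Y} (f : Category._⇒_ C X Y) →
          Category._≈_ D (coe D (eq₀ X) (eq₀ Y) (F₁ F f)) (F₁ G f)

record SetFunctor {o ℓ e} (C : Category o ℓ e) (s : Level)
                  : Set (o ⊔ ℓ ⊔ e ⊔ lsuc s) where
  open Category C
  field
    Sen₀ : Obj → Set s
    Sen₁ : ∀ {A B} → A ⇒ B → Sen₀ A → Sen₀ B
    Sen-identity : ∀ {A} (x : Sen₀ A) → Sen₁ (id {A}) x ≡ x
    Sen-homomorphism : ∀ {A B C′} (f : A ⇒ B) (g : B ⇒ C′) (x : Sen₀ A) →
                       Sen₁ (g ∘ f) x ≡ Sen₁ g (Sen₁ f x)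
    Sen-resp-≈ : ∀ {A B} {f g : A ⇒ B} → f ≈ g → ∀ x → Sen₁ f x ≡ Sen₁ g x

open SetFunctor public

image : ∀ {s} {X Y : Set s} → (X → Y) → Pred X s → Pred Y s
image f Γ y = ∃ λ x → x ∈ Γ × f x ≡ y

record ClosureOp {s} (X : Set s) : Set (lsuc s) where
  field
    C : Pred X s → Pred X s
    extensive  : ∀ Γ → Γ ⊆ C Γ
    monotone   : ∀ {Γ Δ} → Γ ⊆ Δ → C Γ ⊆ C Δ
    idempotent : ∀ Γ → C (C Γ) ⊆ C Γ

open ClosureOp public

record PiInstitution (o ℓ e s : Level) : Set (lsuc (o ⊔ ℓ ⊔ e ⊔ s)) where
  field
    Sig : Category o ℓ e
    Sen : SetFunctor Sig s
    Cl  : ∀ Σ → ClosureOp (Sen₀ Sen Σ)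
    structural : ∀ {Σ₁ Σ₂} (f : Category._⇒_ Sig Σ₁ Σ₂) (Γ : Pred (Sen₀ Sen Σ₁) s) →
                 image (Sen₁ Sen f) (C (Cl Σ₁) Γ) ⊆ C (Cl Σ₂) (image (Sen₁ Sen f) Γ)

open PiInstitution public

record Comorphism {o ℓ e s} (J J′ : PiInstitution o ℓ e s)
                  : Set (o ⊔ ℓ ⊔ e ⊔ lsuc s) where
  field
    Φ : Functor (Sig J) (Sig J′)
    α : ∀ Σ → Sen₀ (Sen J) Σ → Sen₀ (Sen J′) (F₀ Φ Σ)
    natural : ∀ {Σ₁ Σ₂} (f : Category._⇒_ (Sig J) Σ₁ Σ₂) (x : Sen₀ (Sen J) Σ₁) →
              α Σ₂ (Sen₁ (Sen J) f x) ≡ Sen₁ (Sen J′) (F₁ Φ f) (α Σ₁ x)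
    preserves : ∀ Σ (Γ : Pred (Sen₀ (Sen J) Σ) s) (φ : Sen₀ (Sen J) Σ) →
                φ ∈ C (Cl J Σ) Γ → α Σ φ ∈ C (Cl J′ (F₀ Φ Σ)) (image (α Σ) Γ)

open Comorphism public

record _≈co_ {o ℓ e s} {J J′ : PiInstitution o ℓ e s}
             (G H : Comorphism J J′) : Set (o ⊔ ℓ ⊔ e ⊔ lsuc s) where
  field
    Φ-eq : Φ G ≡F Φ H
    α-eq : ∀ Σ (x : Sen₀ (Sen J) Σ) →
           subst (Sen₀ (Sen J′)) (_≡F_.eq₀ Φ-eq Σ) (α G Σ x) ≡ α H Σ x

idCo : ∀ {o ℓ e s} (J : PiInstitution o ℓ e s) → Comorphism J J
idCo J = record
  { Φ = idF (Sig J)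
  ; α = λ Σ x → x
  ; natural = λ f x → refl
  ; preserves = λ Σ Γ φ p →
      monotone (Cl J Σ) (λ {x} x∈Γ → x , x∈Γ , refl) p }

infixr 9 _∘co_
_∘co_ : ∀ {o ℓ e s} {J J′ J″ : PiInstitution o ℓ e s} →
        Comorphism J′ J″ → Comorphism J J′ → Comorphism J J″
_∘co_ {J = J} {J′} {J″} G F = record
  { Φ = Φ G ∘F Φ F
  ; α = λ Σ x → α G (F₀ (Φ F) Σ) (α F Σ x)
  ; natural = λ f x → trans (cong (α G _) (natural F f x)) (natural G (F₁ (Φ F) f) (α F _ x))
  ; preserves = λ Σ Γ φ p →
      monotone (Cl J″ _) sub
        (preserves G (F₀ (Φ F) Σ) (image (α F Σ) Γ) (α F Σ φ) (preserves F Σ Γ φ p)) }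
  where
    sub : ∀ {Σ Γ} → image (α G (F₀ (Φ F) Σ)) (image (α F Σ) Γ) ⊆
                    image (λ x → α G (F₀ (Φ F) Σ) (α F Σ x)) Γ
    sub (_ , (x , x∈Γ , refl) , refl) = x , x∈Γ , refl

U₀ : ∀ {o ℓ e s} → PiInstitution o ℓ e s → Category o ℓ e
U₀ J = Sig J

U₁ : ∀ {o ℓ e s} {J J′ : PiInstitution o ℓ e s} →
     Comorphism J J′ → Functor (U₀ J) (U₀ J′)
U₁ G = Φ G

constSingleton : ∀ {o ℓ e} (A : Category o ℓ e) (s : Level) → SetFunctor A s
constSingleton A s = record
  { Sen₀ = λ _ → ⊤
  ; Sen₁ = λ _ x → x
  ; Sen-identity = λ x → refl
  ; Sen-homomorphism = λ f g x → refl
  ; Sen-resp-≈ = λ p x → refl }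

Con : ∀ {s} → ClosureOp {s} ⊤
Con = record
  { C = λ Γ _ → ⊤
  ; extensive = λ Γ _ → tt
  ; monotone = λ _ _ → tt
  ; idempotent = λ Γ _ → tt }

Top₀ : ∀ {o ℓ e} (s : Level) → Category o ℓ e → PiInstitution o ℓ e s
Top₀ s A = record
  { Sig = A
  ; Sen = constSingleton A s
  ; Cl  = λ _ → Con
  ; structural = λ f Γ _ → tt }

Top₁ : ∀ {o ℓ e} (s : Level) {A B : Category o ℓ e} →
       Functor A B → Comorphism (Top₀ s A) (Top₀ s B)
Top₁ s F = record
  { Φ = F
  ; α = λ _ _ → tt
  ; natural = λ f x → refl
  ; preserves = λ Σ Γ φ _ → tt }

ε : ∀ {o ℓ e} (s : Level) (A : Category o ℓ e) → Functor (U₀ (Top₀ s A)) A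
ε s A = idF A

module Submission where

-- The whole argument rests on one observation: the sentences of ⊤A form
-- the singleton {*}, so a comorphism ⟨Φ , α⟩ : J → ⊤A carries no
-- information beyond its functor Φ : Sig J → A.  Concretely:
--   * every functor F : Sig J → A is the first coordinate of a comorphism
--     ⟨F , !⟩ : J → ⊤A (the transpose of F), and
--   * two comorphisms into ⊤A are equal as soon as their functors are.
-- With these two facts, and the remark that functors with equal actions on
-- objects and morphisms are equal in CAT, the theorem is bookkeeping:
-- the functor laws of ⊤ and the naturality of ε = 1 hold because both
-- sides have the same functor, and ε_A is universal because the transpose
-- ⟨F , !⟩ is the unique comorphism J → ⊤A whose functor is F.

open import Defs
open import Level using (Level)
open import Data.Product using (Σ; _×_; _,_)
open import Relation.Binary.PropositionalEquality using (_≡_; refl)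
open import Relation.Binary.Structures using (IsEquivalence)
open import Data.Unit.Polymorphic using (tt)

-- Used with refl/refl for functors such
-- as 1 ∘ F and F ∘ 1 whose maps coincide but whose law proofs differ.
≡F-from-≡ : ∀ {o ℓ e o′ ℓ′ e′} {C : Category o ℓ e} {D : Category o′ ℓ′ e′}
              {F G : Functor C D}
            (p₀ : ∀ X → F₀ F X ≡ F₀ G X) →
            (∀ {X Y} (f : Category._⇒_ C X Y) → coe D (p₀ X) (p₀ Y) (F₁ F f) ≡ F₁ G f) →
            F ≡F G
≡F-from-≡ {D = D} p₀ p₁ = record
  { eq₀ = p₀
  ; eq₁ = λ f → IsEquivalence.reflexive (Category.equiv D) (p₁ f) }

-- Comorphisms into ⊤A are determined by their functors: the natural
-- transformation component lands in the singleton {*}.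
≈co-into-⊤ : ∀ {o ℓ e s} {J : PiInstitution o ℓ e s} {A : Category o ℓ e}
               {G H : Comorphism J (Top₀ s A)} →
             Φ G ≡F Φ H → G ≈co H
≈co-into-⊤ Φ-eq = record { Φ-eq = Φ-eq ; α-eq = λ _ _ → refl }

-- The transpose ⟨F , !⟩ : J → ⊤A of a functor F : Sig J → A; the closure
-- of ⊤A is total, so every sentence map into {*} preserves consequence.
transpose : ∀ {o ℓ e s} (J : PiInstitution o ℓ e s) (A : Category o ℓ e) →
            Functor (U₀ J) A → Comorphism J (Top₀ s A)
transpose J A F = record
  { Φ = F
  ; α = λ _ _ → tt
  ; natural = λ _ _ → refl
  ; preserves = λ _ _ _ _ → tt }

-- Precomposing with the identity functor does not change a functor, so an
-- equation ε_A ∘ Φ ≡F F (with ε_A = 1_A) is an equation Φ ≡F F.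
unit-cancelˡ : ∀ {o ℓ e o′ ℓ′ e′} {C : Category o ℓ e} {D : Category o′ ℓ′ e′}
                 {F G : Functor C D} →
               (idF D ∘F F) ≡F G → F ≡F G
unit-cancelˡ p = record { eq₀ = _≡F_.eq₀ p ; eq₁ = _≡F_.eq₁ p }

theorem2p3 : ∀ {o ℓ e} (s : Level) →
    ((∀ (A : Category o ℓ e) → Top₁ s (idF A) ≈co idCo (Top₀ s A))
    × (∀ {A B C : Category o ℓ e} (F : Functor A B) (G : Functor B C) →
         Top₁ s (G ∘F F) ≈co (Top₁ s G ∘co Top₁ s F))
    × (∀ {A B : Category o ℓ e} {F G : Functor A B} →
         F ≡F G → Top₁ s F ≈co Top₁ s G))
    × (∀ {A B : Category o ℓ e} (F : Functor A B) →
         (ε s B ∘F U₁ (Top₁ s F)) ≡F (F ∘F ε s A))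
    × (∀ (J : PiInstitution o ℓ e s) (A : Category o ℓ e) (F : Functor (U₀ J) A) →
         Σ (Comorphism J (Top₀ s A)) λ G →
           ((ε s A ∘F U₁ G) ≡F F)
           × (∀ (G′ : Comorphism J (Top₀ s A)) → (ε s A ∘F U₁ G′) ≡F F → G′ ≈co G))
theorem2p3 s =
  -- ⊤ is a functor: in each law both sides have the same underlying functor
  ( (λ A → ≈co-into-⊤ (≡F-from-≡ (λ _ → refl) (λ _ → refl)))
  , (λ F G → ≈co-into-⊤ (≡F-from-≡ (λ _ → refl) (λ _ → refl)))
  , ≈co-into-⊤ )
  -- naturality of ε = 1: both composites are F
  , (λ F → ≡F-from-≡ (λ _ → refl) (λ _ → refl))
  -- universality of ε_A: the transpose, unique by ≈co-into-⊤
  , λ J A F →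
      transpose J A F
      , ≡F-from-≡ (λ _ → refl) (λ _ → refl)
      , λ G′ εG′≡F → ≈co-into-⊤ (unit-cancelˡ εG′≡F)
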